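{- Let $L$ be a complete lattice, $F\colon L\to L$ an $\omega$-continuous function, and $\alpha\in L$. Let $n\ge2$ and $0<i\le n-1$, let $C=(C_i,\dots,C_{n-1})$ be a Kleene sequence indexed from $i$, and let $X=(X_0\le\cdots\le X_{n-1})$ be a KT sequence. Then: (1) if $C_i\not\le X_i$, then $C$ cannot be extended to a conclusive Kleene sequence, i.e. there are no $C_0,\dots,C_{i-1}$ such that $(C_0,\dots,C_{n-1})$ is a conclusive Kleene sequence; (2) if $C_i\not\le FX_{i-1}$, then $C$ cannot be extended to a conclusive Kleene sequence; (3) there is no conclusive Kleene sequence of length $n-1$.
   Context: $\omega$-continuous means preserving suprema of increasing $\omega$-chains. A KT sequence is a finite chain $X=(X_0\le\cdots\le X_{n-1})$ in $L$ with $n\ge 2$, $X_{n-2}\le\alpha$ and $FX_j\le X_{j+1}$ for all $0\le j\le n-2$. A Kleene sequence indexed from $i$ is a finite sequence $(C_i,\dots,C_{n-1})$ in $L$ with $C_j\le FC_{j-1}$ for $i+1\le j\le n-1$ and $C_{n-1}\not\le\alpha$; a Kleene sequence $(C_0,\dots,C_{m-1})$ indexed from $0$ is conclusive if $C_0=\bot$. -}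

module Defs where

open import Level using (Level; _⊔_; Lift)
open import Data.Empty renaming (⊥ to Empty)
open import Data.Nat using (ℕ; suc; _≤_; _<_; _∸_)
open import Data.Product using (Σ; _×_; ∃-syntax)
open import Relation.Nullary using (¬_)
open import Relation.Unary using (Pred)
open import Relation.Binary.PropositionalEquality using (_≡_)
open import Relation.Binary.Structures using (IsPartialOrder)

record CompleteLattice (c ℓ : Level) : Set (Level.suc (c ⊔ ℓ)) where
  infix 4 _⊑_
  field
    Carrier        : Set c
    _⊑_            : Carrier → Carrier → Set ℓ
    isPartialOrder : IsPartialOrder _≡_ _⊑_
    ⋁              : Pred Carrier c → Carrier
    ⋁-upper        : ∀ (P : Pred Carrier c) x → P x → x ⊑ ⋁ P
    ⋁-least        : ∀ (P : Pred Carrier c) y → (∀ x → P x → x ⊑ y) → ⋁ P ⊑ y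

  ⊥L : Carrier
  ⊥L = ⋁ (λ _ → Lift c Empty)

module _ {c ℓ : Level} (L : CompleteLattice c ℓ) where
  open CompleteLattice L

  Range : (ℕ → Carrier) → Pred Carrier c
  Range s y = ∃[ k ] (y ≡ s k)

  OmegaContinuous : (Carrier → Carrier) → Set (c ⊔ ℓ)
  OmegaContinuous F = ∀ (s : ℕ → Carrier) → (∀ k → s k ⊑ s (suc k)) →
    F (⋁ (Range s)) ≡ ⋁ (Range (λ k → F (s k)))

  -- X = (X_0 ≤ ... ≤ X_{n-1}) is a KT sequence (only indices < n are relevant)
  IsKT : (Carrier → Carrier) → Carrier → ℕ → (ℕ → Carrier) → Set ℓ
  IsKT F α n X =
    (2 ≤ n) ×
    (∀ j → suc j < n → X j ⊑ X (suc j)) ×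
    (X (n ∸ 2) ⊑ α) ×
    (∀ j → suc j < n → F (X j) ⊑ X (suc j))

  -- (C_i, ..., C_{n-1}) is a Kleene sequence indexed from i
  -- (only indices i ≤ j < n are relevant)
  IsKleeneFrom : (Carrier → Carrier) → Carrier → ℕ → ℕ → (ℕ → Carrier) → Set ℓ
  IsKleeneFrom F α i n C =
    (i < n) ×
    (∀ j → i ≤ j → suc j < n → C (suc j) ⊑ F (C j)) ×
    (¬ (C (n ∸ 1) ⊑ α))

  IsConclusive : (Carrier → Carrier) → Carrier → ℕ → (ℕ → Carrier) → Set (c ⊔ ℓ)
  IsConclusive F α m C = IsKleeneFrom F α 0 m C × (C 0 ≡ ⊥L)

  ExtendsToConclusive : (Carrier → Carrier) → Carrier → ℕ → ℕ → (ℕ → Carrier) → Set (c ⊔ ℓ)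
  ExtendsToConclusive F α i n C =
    ∃[ D ] ((∀ j → i ≤ j → j < n → D j ≡ C j) × IsConclusive F α n D)

{-# OPTIONS --safe #-}
module Submission where

-- A conclusive Kleene sequence D stays pointwise below every KT sequence X of at
-- least its length: D₀ = ⊥ ⊑ X₀, and D_{j+1} ⊑ F D_j ⊑ F X_j ⊑ X_{j+1}, where F is
-- monotone because it is ω-continuous. An extension of C would therefore force
-- C_i ⊑ X_i and C_i ⊑ F X_{i-1}, and a conclusive sequence of length n - 1 would
-- end below X_{n-2} ⊑ α.

open import Defs
open import Level using (Level; lower)
open import Data.Empty using (⊥-elim)
open import Data.Nat using (ℕ; zero; suc; _≤_; _<_; _∸_; z≤n)
open import Data.Nat.Properties using (≤-trans; ≤-refl; <-trans; n<1+n; n≤1+n)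
open import Data.Product using (_×_; ∃-syntax; _,_)
open import Relation.Nullary using (¬_)
open import Relation.Binary.PropositionalEquality using (_≡_; refl; sym; subst)
open import Relation.Binary.Structures using (IsPartialOrder)

module _ {c ℓ : Level} (L : CompleteLattice c ℓ) where
  open CompleteLattice L
  open IsPartialOrder isPartialOrder using (antisym; trans; reflexive)

  ⊥L-least : ∀ x → ⊥L ⊑ x
  ⊥L-least x = ⋁-least _ x (λ _ empty → ⊥-elim (lower empty))

  ωContinuous⇒monotone : ∀ F → OmegaContinuous L F → ∀ {a b} → a ⊑ b → F a ⊑ F b
  ωContinuous⇒monotone F cont {a} {b} a⊑b =
    subst (F a ⊑_) (sym F-b≡⋁) (⋁-upper _ (F a) (0 , refl))
    where
    s : ℕ → Carrier
    s zero    = a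
    s (suc _) = b

    s-below-b : ∀ k → s k ⊑ b
    s-below-b zero    = a⊑b
    s-below-b (suc _) = reflexive refl

    s-increasing : ∀ k → s k ⊑ s (suc k)
    s-increasing = s-below-b

    ⋁s≡b : ⋁ (Range L s) ≡ b
    ⋁s≡b = antisym (⋁-least _ b (λ { _ (k , refl) → s-below-b k }))
                   (⋁-upper _ b (1 , refl))

    F-b≡⋁ : F b ≡ ⋁ (Range L (λ k → F (s k)))
    F-b≡⋁ = subst (λ z → F z ≡ ⋁ (Range L (λ k → F (s k)))) ⋁s≡b
                  (cont s s-increasing)

  module _ (F : Carrier → Carrier) (cont : OmegaContinuous L F) {α : Carrier}
           {m n : ℕ} (m≤n : m ≤ n) {D X : ℕ → Carrier}
           (D-conclusive : IsConclusive L F α m D) (X-KT : IsKT L F α n X) where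

    private
      D₀≡⊥ : D 0 ≡ ⊥L
      D₀≡⊥ = let (_ , D₀≡⊥) = D-conclusive in D₀≡⊥

      D-kleene : ∀ j → 0 ≤ j → suc j < m → D (suc j) ⊑ F (D j)
      D-kleene = let ((_ , D-kleene , _) , _) = D-conclusive in D-kleene

      X-post : ∀ j → suc j < n → F (X j) ⊑ X (suc j)
      X-post = let (_ , _ , _ , X-post) = X-KT in X-post

    mutual
      conclusive⊑KT : ∀ j → j < m → D j ⊑ X j
      conclusive⊑KT zero    _      = subst (_⊑ X 0) (sym D₀≡⊥) (⊥L-least (X 0))
      conclusive⊑KT (suc j) 1+j<m  =
        trans (conclusive-suc⊑F-KT j 1+j<m) (X-post j (≤-trans 1+j<m m≤n))

      conclusive-suc⊑F-KT : ∀ j → suc j < m → D (suc j) ⊑ F (X j)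
      conclusive-suc⊑F-KT j 1+j<m =
        trans (D-kleene j z≤n 1+j<m)
              (ωContinuous⇒monotone F cont (conclusive⊑KT j (<-trans (n<1+n j) 1+j<m)))

proposition3 : ∀ {c ℓ : Level} (L : CompleteLattice c ℓ) →
    let open CompleteLattice L in
    (F : Carrier → Carrier) → OmegaContinuous L F → (α : Carrier) →
    (n i : ℕ) → 2 ≤ n → 0 < i → i ≤ n ∸ 1 →
    (C X : ℕ → Carrier) → IsKleeneFrom L F α i n C → IsKT L F α n X →
      ((¬ (C i ⊑ X i)) → ¬ ExtendsToConclusive L F α i n C) ×
      ((¬ (C i ⊑ F (X (i ∸ 1)))) → ¬ ExtendsToConclusive L F α i n C) ×
      (¬ (∃[ D ] IsConclusive L F α (n ∸ 1) D))
proposition3 L F cont α n@(suc (suc k)) (suc i) _ _ _ C X (i<n , _) X-KT =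
  below-X , below-FX , no-short-conclusive
  where
  open CompleteLattice L
  open IsPartialOrder isPartialOrder using (trans)

  D≡C : ∀ D → (∀ j → suc i ≤ j → j < n → D j ≡ C j) → D (suc i) ≡ C (suc i)
  D≡C D agree = agree (suc i) ≤-refl i<n

  below-X : ¬ (C (suc i) ⊑ X (suc i)) → ¬ ExtendsToConclusive L F α (suc i) n C
  below-X C⋢X (D , agree , D-conclusive) =
    C⋢X (subst (_⊑ X (suc i)) (D≡C D agree)
          (conclusive⊑KT L F cont ≤-refl D-conclusive X-KT (suc i) i<n))

  below-FX : ¬ (C (suc i) ⊑ F (X i)) → ¬ ExtendsToConclusive L F α (suc i) n C
  below-FX C⋢FX (D , agree , D-conclusive) =
    C⋢FX (subst (_⊑ F (X i)) (D≡C D agree)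
           (conclusive-suc⊑F-KT L F cont ≤-refl D-conclusive X-KT i i<n))

  no-short-conclusive : ¬ (∃[ D ] IsConclusive L F α (suc k) D)
  no-short-conclusive (D , D-conclusive@((_ , _ , Dₖ⋢α) , _)) =
    let (_ , _ , Xₖ⊑α , _) = X-KT in
    Dₖ⋢α (trans (conclusive⊑KT L F cont (n≤1+n (suc k)) D-conclusive X-KT k (n<1+n k)) Xₖ⊑α)
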